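{- Let $H$ be a graph. Then (1) $c^*(H)$ equals the maximum, over all incomparable sets $L\subseteq V(H)$, of the largest size of an inclusion-minimal set $S\subseteq V(H)$ that has no common neighbor in $L$; and (2) $d^*(H)$ equals the maximum $d$ such that there exist an incomparable set $L\subseteq V(H)$, distinct vertices $x_1,\dots,x_d$ and not necessarily distinct vertices $x_1',\dots,x_d'$ forming a lower bound structure of order $d$.
   Context: Graphs may have loops; $N(v)$ is the neighborhood of $v$. Vertices $u,v$ are incomparable if $N(u)\not\subseteq N(v)$ and $N(v)\not\subseteq N(u)$; a set is incomparable if its vertices are pairwise incomparable. A set $S$ has a common neighbor in $L$ if some vertex of $L$ is adjacent to every vertex of $S$. $c^*(H)$ is the maximum over all $L\subseteq V(H)$ of the largest size of an inclusion-minimal $S\subseteq V(H)$ without a common neighbor in $L$. A lower bound structure of order $d$ is a set $L\subseteq V(H)$ with distinct $x_1,\dots,x_d$ and not necessarily distinct $x_1',\dots,x_d'$ such that $x_i$ is incomparable with $x_i'$ for all $i$, $\bigcap_i N(x_i)\cap L=\emptyset$, and $\bigcap_i N(y_i)\cap L\ne\emptyset$ for every choice $y_i\in\{x_i,x_i'\}$ with $y_i=x_i'$ for at least one $i$. $d^*(H)$ is the largest order of a lower bound structure in $H$ (with arbitrary $L$). -}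

module Defs where

open import Data.Nat using (ℕ; _≤_)
open import Data.Unit using (⊤)
open import Data.Bool using (Bool; true; false)
open import Data.Fin using (Fin)
open import Data.Fin.Subset using (Subset; _∈_; _⊆_; _⊈_; _⊂_; ∣_∣)
open import Data.Vec using (tabulate)
open import Data.Product using (Σ; ∃; _×_; _,_)
open import Relation.Binary.PropositionalEquality using (_≡_; _≢_)
open import Relation.Nullary using (¬_)
open import Function.Definitions using (Injective)

-- A finite graph, loops allowed: vertex set Fin n, symmetric Boolean adjacency.
record Graph : Set where
  field
    n   : ℕ
    adj : Fin n → Fin n → Bool
    sym : ∀ u v → adj u v ≡ adj v u

open Graph public

module _ (H : Graph) where
  V : Set
  V = Fin (n H)

  N : V → Subset (n H)
  N v = tabulate (λ u → adj H v u)

  Incomparable : V → V → Set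
  Incomparable u v = (N u ⊈ N v) × (N v ⊈ N u)

  IncomparableSet : Subset (n H) → Set
  IncomparableSet L = ∀ u v → u ∈ L → v ∈ L → u ≢ v → Incomparable u v

  HasCommonNeighbor : Subset (n H) → Subset (n H) → Set
  HasCommonNeighbor L S = ∃ λ w → w ∈ L × (∀ s → s ∈ S → s ∈ N w)

  MinimalNoCommonNeighbor : Subset (n H) → Subset (n H) → Set
  MinimalNoCommonNeighbor L S =
    ¬ HasCommonNeighbor L S × (∀ T → T ⊂ S → HasCommonNeighbor L T)

  CValue : (Subset (n H) → Set) → ℕ → Set
  CValue P k = ∃ λ L → P L × ∃ λ S → MinimalNoCommonNeighbor L S × ∣ S ∣ ≡ k

  LowerBoundStructure : (d : ℕ) → Subset (n H) → (Fin d → V) → (Fin d → V) → Set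
  LowerBoundStructure d L x x' =
    Injective _≡_ _≡_ x
    × (∀ i → Incomparable (x i) (x' i))
    × ¬ (∃ λ w → w ∈ L × (∀ i → w ∈ N (x i)))
    × (∀ (c : Fin d → Bool) → (∃ λ i → c i ≡ true) →
         ∃ λ w → w ∈ L × (∀ i → w ∈ N (choose c x x' i)))
    where
    choose : (Fin d → Bool) → (Fin d → V) → (Fin d → V) → Fin d → V
    choose c x x' i with c i
    ... | true  = x' i
    ... | false = x i

  DValue : (Subset (n H) → Set) → ℕ → Set
  DValue P d = ∃ λ L → P L × ∃ λ x → ∃ λ x' → LowerBoundStructure d L x x'

IsMaximum : (ℕ → Set) → ℕ → Set
IsMaximum P m = P m × (∀ k → P k → k ≤ m)

AnyL : ∀ {m} → Subset m → Set
AnyL _ = ⊤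

-- c*(H) and d*(H) as defined in the paper (maximum over arbitrary L)
IsCStar : Graph → ℕ → Set
IsCStar H = IsMaximum (CValue H AnyL)

IsDStar : Graph → ℕ → Set
IsDStar H = IsMaximum (DValue H AnyL)

-- Removing from L a vertex u whose neighbourhood lies inside that of another vertex v of L
-- changes no statement "some vertex of L is adjacent to all of X": whenever u is such a
-- witness, so is v. Repeating this, every L shrinks to an incomparable L' with exactly the
-- same common-neighbour behaviour, so both for c* and for d* the values attained with
-- arbitrary L and with incomparable L coincide, and hence so do their maxima.
module Submission where

open import Defs
open import Data.Nat using (ℕ; _<_)
open import Data.Nat.Induction using (<-wellFounded)
open import Induction.WellFounded using (Acc; acc)
open import Data.Unit using (tt)
open import Data.Fin using (Fin; _≟_)
open import Data.Fin.Properties using (any?)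
open import Data.Fin.Subset using (Subset; inside; _∈_; _⊆_; _-_; ∣_∣)
open import Data.Fin.Subset.Properties
  using (_∈?_; _⊆?_; ⊆-refl; ⊆-trans; x∈p∧x≢y⇒x∈p-y; x∈p⇒∣p-x∣<∣p∣; p─q⊆p)
open import Data.Vec using (lookup)
open import Data.Vec.Properties using (lookup∘tabulate; []=⇒lookup; lookup⇒[]=)
open import Data.Product using (∃; _×_; _,_; map₁; map₂)
open import Function using (_∘_)
open import Function.Bundles using (_⇔_; mk⇔; Equivalence)
open import Relation.Binary.PropositionalEquality using (_≢_; refl; ≢-sym; module ≡-Reasoning)
open import Relation.Nullary using (¬_; Dec; yes; no; ¬?)
open import Relation.Nullary.Decidable using (_×-dec_)

module _ (H : Graph) where

  ∈N-sym : ∀ {u v} → u ∈ N H v → v ∈ N H u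
  ∈N-sym {u} {v} u∈Nv = lookup⇒[]= v (N H u) (begin
    lookup (N H u) v  ≡⟨ lookup∘tabulate (adj H u) v ⟩
    adj H u v         ≡⟨ Graph.sym H u v ⟩
    adj H v u         ≡⟨ lookup∘tabulate (adj H v) u ⟨
    lookup (N H v) u  ≡⟨ []=⇒lookup u∈Nv ⟩
    inside            ∎)
    where open ≡-Reasoning

  Dominates : Subset (n H) → Subset (n H) → Set
  Dominates L' L = ∀ {w} → w ∈ L → ∃ λ w' → w' ∈ L' × N H w ⊆ N H w'

  Dominates-refl : ∀ {L} → Dominates L L
  Dominates-refl {w = w} w∈L = w , w∈L , ⊆-refl

  Dominates-trans : ∀ {L₁ L₂ L₃} → Dominates L₁ L₂ → Dominates L₂ L₃ → Dominates L₁ L₃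
  Dominates-trans dom₁₂ dom₂₃ w∈L₃ with dom₂₃ w∈L₃
  ... | w₂ , w₂∈L₂ , Nw⊆Nw₂ = map₂ (map₂ (⊆-trans Nw⊆Nw₂)) (dom₁₂ w₂∈L₂)

  ComparablePair : Subset (n H) → Set
  ComparablePair L = ∃ λ u → ∃ λ v → u ∈ L × v ∈ L × u ≢ v × N H u ⊆ N H v

  comparablePair? : ∀ L → Dec (ComparablePair L)
  comparablePair? L = any? λ u → any? λ v →
    (u ∈? L) ×-dec (v ∈? L) ×-dec ¬? (u ≟ v) ×-dec (N H u ⊆? N H v)

  noComparablePair⇒incomparable : ∀ {L} → ¬ ComparablePair L → IncomparableSet H L
  noComparablePair⇒incomparable noPair u v u∈L v∈L u≢v =
      (λ Nu⊆Nv → noPair (u , v , u∈L , v∈L , u≢v , Nu⊆Nv))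
    , (λ Nv⊆Nu → noPair (v , u , v∈L , u∈L , ≢-sym u≢v , Nv⊆Nu))

  dominatedRemoval : ∀ {L u v} → u ∈ L → v ∈ L → u ≢ v → N H u ⊆ N H v →
                     Dominates (L - u) L
  dominatedRemoval {u = u} {v} u∈L v∈L u≢v Nu⊆Nv {w} w∈L with w ≟ u
  ... | yes refl = v , x∈p∧x≢y⇒x∈p-y v∈L (≢-sym u≢v) , Nu⊆Nv
  ... | no w≢u   = w , x∈p∧x≢y⇒x∈p-y w∈L w≢u , ⊆-refl

  IncomparableCore : Subset (n H) → Set
  IncomparableCore L = ∃ λ L' → L' ⊆ L × IncomparableSet H L' × Dominates L' L

  incomparableCore : ∀ L → IncomparableCore L
  incomparableCore L = go L (<-wellFounded ∣ L ∣)
    where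
    go : ∀ L → Acc _<_ ∣ L ∣ → IncomparableCore L
    go L (acc rec) with comparablePair? L
    ... | no noPair = L , ⊆-refl , noComparablePair⇒incomparable noPair , Dominates-refl
    ... | yes (u , v , u∈L , v∈L , u≢v , Nu⊆Nv)
      with go (L - u) (rec (x∈p⇒∣p-x∣<∣p∣ u∈L))
    ... | L' , L'⊆L-u , inc , dom =
      L' , p─q⊆p L _ ∘ L'⊆L-u , inc , Dominates-trans dom (dominatedRemoval u∈L v∈L u≢v Nu⊆Nv)

  Witnessed : Subset (n H) → (V H → Set) → Set
  Witnessed L Q = ∃ λ w → w ∈ L × Q w

  NeighbourhoodMonotone : (V H → Set) → Set
  NeighbourhoodMonotone Q = ∀ {w w'} → N H w ⊆ N H w' → Q w → Q w'

  witnessed-core : ∀ {L' L Q} → L' ⊆ L → Dominates L' L → NeighbourhoodMonotone Q →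
                   Witnessed L Q ⇔ Witnessed L' Q
  witnessed-core L'⊆L dom mono = mk⇔ to (map₂ (map₁ L'⊆L))
    where
    to : Witnessed _ _ → Witnessed _ _
    to (w , w∈L , Qw) with dom w∈L
    ... | w' , w'∈L' , Nw⊆Nw' = w' , w'∈L' , mono Nw⊆Nw' Qw

  covers-monotone : ∀ S → NeighbourhoodMonotone (λ w → ∀ s → s ∈ S → s ∈ N H w)
  covers-monotone S Nw⊆Nw' cov s s∈S = Nw⊆Nw' (cov s s∈S)

  adjacentToAll-monotone : ∀ {d} (y : Fin d → V H) →
                           NeighbourhoodMonotone (λ w → ∀ i → w ∈ N H (y i))
  adjacentToAll-monotone y Nw⊆Nw' adj i = ∈N-sym (Nw⊆Nw' (∈N-sym (adj i)))

  CValue-incomparable : ∀ {k} → CValue H AnyL k → CValue H (IncomparableSet H) k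
  CValue-incomparable (L , _ , S , (noCN , minimal) , ∣S∣≡k) with incomparableCore L
  ... | L' , L'⊆L , inc , dom =
    L' , inc , S , (noCN ∘ from (core S) , λ T T⊂S → to (core T) (minimal T T⊂S)) , ∣S∣≡k
    where
    open Equivalence
    core : ∀ T → HasCommonNeighbor H L T ⇔ HasCommonNeighbor H L' T
    core T = witnessed-core L'⊆L dom (covers-monotone T)

  DValue-incomparable : ∀ {d} → DValue H AnyL d → DValue H (IncomparableSet H) d
  DValue-incomparable (L , _ , x , x' , inj , incₓ , noCN , mixedCN) with incomparableCore L
  ... | L' , L'⊆L , inc , dom =
    L' , inc , x , x' , inj , incₓ , noCN ∘ from (core x) , λ c c≢0 → to (core _) (mixedCN c c≢0)
    where
    open Equivalence
    core : ∀ y → Witnessed L (λ w → ∀ i → w ∈ N H (y i)) ⇔ Witnessed L' (λ w → ∀ i → w ∈ N H (y i))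
    core y = witnessed-core L'⊆L dom (adjacentToAll-monotone y)

CValue-anyL : ∀ H {P k} → CValue H P k → CValue H AnyL k
CValue-anyL _ (L , _ , S) = L , tt , S

DValue-anyL : ∀ H {P d} → DValue H P d → DValue H AnyL d
DValue-anyL _ (L , _ , lbs) = L , tt , lbs

IsMaximum-cong : ∀ {P Q : ℕ → Set} → (∀ {k} → P k → Q k) → (∀ {k} → Q k → P k) →
                 ∀ m → IsMaximum P m ⇔ IsMaximum Q m
IsMaximum-cong P⇒Q Q⇒P m = mk⇔
  (λ (Pm , maxP) → P⇒Q Pm , λ k Qk → maxP k (Q⇒P Qk))
  (λ (Qm , maxQ) → Q⇒P Qm , λ k Pk → maxQ k (P⇒Q Pk))

mainTheorem5 : (H : Graph) →
    (∀ m → IsCStar H m ⇔ IsMaximum (CValue H (IncomparableSet H)) m)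
    × (∀ m → IsDStar H m ⇔ IsMaximum (DValue H (IncomparableSet H)) m)
mainTheorem5 H =
    IsMaximum-cong (CValue-incomparable H) (CValue-anyL H)
  , IsMaximum-cong (DValue-incomparable H) (DValue-anyL H)
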